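{- If $G$ is a block graph, then $\mathrm{nim}(\mathrm{DNG}(G))=1-\mathrm{pty}(V)$.
   Context: A block of a graph is a maximal connected subgraph without a cut vertex; a block graph is a graph all of whose blocks are complete graphs. For a graph $G=(V,E)$, a set of vertices is geodetically convex if it contains every vertex on every shortest path between two of its vertices; the convex hull $[P]$ is the smallest convex set containing $P$, and $P$ is generating if $[P]=V$. In the avoidance game $\mathrm{DNG}(G)$, two players alternately select previously-unselected vertices such that the selected set never generates; the player who cannot move loses. $\mathrm{nim}$ denotes the nim-number of an impartial game, and $\mathrm{pty}(V):=|V|\bmod 2$. -}

module Defs where

open import Data.Nat using (ℕ; zero; suc; _<_; _≤_; _∸_; _%_)
open import Data.Fin using (Fin)
open import Data.Fin.Subset using (Subset; _∈_; _∉_; _⊆_; _∪_; ⁅_⁆; ⊥; Nonempty)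
open import Data.Bool using (Bool; true; false)
open import Data.Product using (Σ; _×_; _,_; ∃)
open import Relation.Binary.PropositionalEquality using (_≡_; _≢_)
open import Relation.Nullary using (¬_)

record Graph (n : ℕ) : Set where
  field
    adj     : Fin n → Fin n → Bool
    sym     : ∀ u v → adj u v ≡ adj v u
    irrefl  : ∀ v → adj v v ≡ false

open Graph public

Adj : ∀ {n} → Graph n → Fin n → Fin n → Set
Adj G u v = adj G u v ≡ true

data WalkIn {n} (G : Graph n) (S : Subset n) : Fin n → Fin n → ℕ → Set where
  here  : ∀ {u} → u ∈ S → WalkIn G S u u zero
  step  : ∀ {u w v k} → u ∈ S → Adj G u w → WalkIn G S w v k → WalkIn G S u v (suc k)

Walk : ∀ {n} → Graph n → Fin n → Fin n → ℕ → Set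
Walk {n} G = WalkIn G (Data.Fin.Subset.⊤)

data OnWalk {n} {G : Graph n} {S : Subset n} (x : Fin n) :
     ∀ {u v k} → WalkIn G S u v k → Set where
  at-here  : ∀ {p} → OnWalk x (here {u = x} p)
  at-step  : ∀ {w v k p e} {r : WalkIn G S w v k} → OnWalk x (step {u = x} p e r)
  later    : ∀ {u w v k p e} {r : WalkIn G S w v k} → OnWalk x r → OnWalk x (step {u = u} p e r)

Geodesic : ∀ {n} → Graph n → Fin n → Fin n → ℕ → Set
Geodesic G u v k = Walk G u v k × (∀ m → Walk G u v m → k ≤ m)

ConnectedIn : ∀ {n} → Graph n → Subset n → Set
ConnectedIn G S = ∀ u v → u ∈ S → v ∈ S → ∃ λ k → WalkIn G S u v k

Connected : ∀ {n} → Graph n → Set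
Connected G = ConnectedIn G Data.Fin.Subset.⊤

_─_ : ∀ {n} → Subset n → Fin n → Subset n
S ─ v = Data.Fin.Subset._∩_ S (Data.Fin.Subset.∁ ⁅ v ⁆)

Biconn : ∀ {n} → Graph n → Subset n → Set
Biconn G S = ConnectedIn G S × (∀ v → v ∈ S → ConnectedIn G (S ─ v))

IsBlock : ∀ {n} → Graph n → Subset n → Set
IsBlock G S = Biconn G S × (∀ T → S ⊆ T → Biconn G T → T ⊆ S)

IsBlockGraph : ∀ {n} → Graph n → Set
IsBlockGraph G = ∀ S → IsBlock G S → ∀ u v → u ∈ S → v ∈ S → u ≢ v → Adj G u v

Convex : ∀ {n} → Graph n → Subset n → Set
Convex G C = ∀ u v k → u ∈ C → v ∈ C → (g : Geodesic G u v k) →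
             ∀ x → OnWalk x (Data.Product.proj₁ g) → x ∈ C

-- The convex hull [P]: the smallest convex set containing P
-- (the intersection of all convex supersets of P).
Hull-member : ∀ {n} → Graph n → Fin n → Subset n → Set
Hull-member G x P = ∀ C → Convex G C → P ⊆ C → x ∈ C

Generating : ∀ {n} → Graph n → Subset n → Set
Generating G P = ∀ x → Hull-member G x P

-- The avoidance game DNG(G): positions are selected sets P;
-- a move from P selects an unselected vertex v such that P ∪ {v} is not generating.
Option : ∀ {n} → Graph n → Subset n → Subset n → Set
Option G P Q = ∃ λ v → v ∉ P × Q ≡ P ∪ ⁅ v ⁆ × ¬ Generating G Q

Legal : ∀ {n} → Graph n → Subset n → Set
Legal G P = ¬ Generating G P

IsMex : ∀ {n} → Graph n → (Subset n → ℕ) → Subset n → ℕ → Set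
IsMex G g P k = (∀ j → j < k → ∃ λ Q → Option G P Q × g Q ≡ j)
              × (∀ Q → Option G P Q → g Q ≢ k)

NimAssignment : ∀ {n} → Graph n → (Subset n → ℕ) → Set
NimAssignment G g = ∀ P → Legal G P → IsMex G g P (g P)

NimDNG≡ : ∀ {n} → Graph n → ℕ → Set
NimDNG≡ G k = Σ (Subset _ → ℕ) λ g → NimAssignment G g × g ⊥ ≡ k

pty : ℕ → ℕ
pty n = n % 2

-- In a block graph every vertex lies on a geodesic between two simplicial vertices:
-- a geodesic whose end b is not simplicial can be prolonged beyond b, because two
-- non-adjacent neighbours of b lie in different blocks, so b separates them and one
-- of them is farther from the other end. Hence every set containing all simplicial
-- vertices is generating, while the complement of a simplicial vertex is convex. So
-- every non-generating set with at most |V| - 2 elements can be extended, every play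
-- of DNG(G) lasts exactly |V| - 1 moves, and the nim-number of a position is the
-- parity of the number of moves left.

module Submission where

open import Defs
open import Data.Bool as Bool using (true)
open import Data.Fin using (Fin; zero; suc)
open import Data.Fin.Properties using (_≟_; all?; any?)
open import Data.Fin.Subset
  using (Subset; _∈_; _∉_; _⊆_; _⊂_; _⊃_; _∪_; ∁; ⁅_⁆; ∣_∣; inside; outside)
  renaming (⊥ to ∅; ⊤ to full)
open import Data.Fin.Subset.Induction using (Acc; acc; ⊃-wellFounded)
open import Data.Fin.Subset.Properties
  using (_∈?_; ∈⊤; ⊆-refl; ⊆-trans; ∣p∣≤n; ∣p∣≡n⇒p≡⊤; ∣⊥∣≡0; ∣⁅x⁆∣≡1; x∈⁅x⁆; x∈⁅y⁆⇒x≡y;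
         x≢y⇒x∉⁅y⁆; x∉⁅y⁆⇒x≢y; x∈∁p⇒x∉p; x∉p⇒x∈∁p; x∈p∩q⁺; x∈p∩q⁻; x∈p∪q⁻; p⊆p∪q; q⊆p∪q;
         ∪-identityʳ)
open import Data.Nat using (ℕ; zero; suc; _+_; _∸_; _%_; _≤_; _<_; z≤n; s≤s)
open import Data.Nat.Properties
  using (≤-refl; ≤-trans; <-≤-trans; ≤∧≢⇒<; <⇒≱; ≰⇒>; ≮⇒≥; n≮0; m≤n+m; m≤n⇒m≤1+n; ≤-pred;
         m≤n⇒m∸n≡0; +-suc; +-identityʳ; +-∸-assoc; _<?_)
open import Data.Product using (Σ; ∃; ∃₂; _×_; _,_; proj₁; proj₂)
open import Data.Sum as Sum using (_⊎_; inj₁; inj₂)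
open import Data.Unit using (⊤; tt)
open import Data.Vec as Vec using (_∷_)
open import Effect.Monad using (RawMonad)
open import Function using (_∘_; id; case_of_)
open import Level using (0ℓ)
open import Relation.Nullary using (¬_; Dec; yes; no; contradiction)
open import Relation.Nullary.Decidable using (decidable-stable; ¬¬-excluded-middle; ¬?; _×-dec_; _→-dec_)
open import Relation.Nullary.Negation using (¬¬-Monad)
open import Relation.Binary.PropositionalEquality as ≡ using (_≡_; _≢_; refl; trans; subst; cong; ≢-sym)

open RawMonad (¬¬-Monad {a = 0ℓ})

private
  variable
    n k l : ℕ
    G : Graph n
    S T P Q : Subset n
    a b c s u v w x y z : Fin n

n%2≢[1+n]%2 : ∀ n → n % 2 ≢ suc n % 2
n%2≢[1+n]%2 zero ()
n%2≢[1+n]%2 (suc zero) ()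
n%2≢[1+n]%2 (suc (suc n)) = n%2≢[1+n]%2 n

m<[1+n]%2⇒n%2≡m : ∀ n {m} → m < suc n % 2 → n % 2 ≡ m
m<[1+n]%2⇒n%2≡m zero (s≤s z≤n) = refl
m<[1+n]%2⇒n%2≡m (suc zero) ()
m<[1+n]%2⇒n%2≡m (suc (suc n)) = m<[1+n]%2⇒n%2≡m n

n%2≡1∸[1+n]%2 : ∀ n → n % 2 ≡ 1 ∸ suc n % 2
n%2≡1∸[1+n]%2 zero = refl
n%2≡1∸[1+n]%2 (suc zero) = refl
n%2≡1∸[1+n]%2 (suc (suc n)) = n%2≡1∸[1+n]%2 n

x∉p⇒∣p∪⁅x⁆∣≡1+∣p∣ : {p : Subset n} → x ∉ p → ∣ p ∪ ⁅ x ⁆ ∣ ≡ suc ∣ p ∣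
x∉p⇒∣p∪⁅x⁆∣≡1+∣p∣ {x = zero} {inside ∷ p} x∉p = contradiction Vec.here x∉p
x∉p⇒∣p∪⁅x⁆∣≡1+∣p∣ {x = zero} {outside ∷ p} x∉p = cong (suc ∘ ∣_∣) (∪-identityʳ p)
x∉p⇒∣p∪⁅x⁆∣≡1+∣p∣ {x = suc _} {inside ∷ _} x∉p = cong suc (x∉p⇒∣p∪⁅x⁆∣≡1+∣p∣ (x∉p ∘ Vec.there))
x∉p⇒∣p∪⁅x⁆∣≡1+∣p∣ {x = suc _} {outside ∷ _} x∉p = x∉p⇒∣p∪⁅x⁆∣≡1+∣p∣ (x∉p ∘ Vec.there)

∣p∣<n⇒∃∉ : {p : Subset n} → ∣ p ∣ < n → ∃ (_∉ p)
∣p∣<n⇒∃∉ {p = outside ∷ p} _ = zero , λ ()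
∣p∣<n⇒∃∉ {p = inside ∷ p} (s≤s ∣p∣<n) with ∣p∣<n⇒∃∉ ∣p∣<n
... | x , x∉p = suc x , λ { (Vec.there x∈p) → x∉p x∈p }

-- Games in which every maximal play has the same length

option-size : Option G P Q → ∣ Q ∣ ≡ suc ∣ P ∣
option-size (_ , v∉P , refl , _) = x∉p⇒∣p∪⁅x⁆∣≡1+∣p∣ v∉P

module _ (G : Graph n) (m : ℕ)
         (legal⇒size≤ : ∀ {P} → Legal G P → ∣ P ∣ ≤ m)
         (legal⇒option : ∀ {P} → Legal G P → ∣ P ∣ < m → ∃ (Option G P)) where

  option⇒remaining-moves : Option G P Q → m ∸ ∣ P ∣ ≡ suc (m ∸ ∣ Q ∣)
  option⇒remaining-moves o@(_ , _ , _ , legal-Q)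
    rewrite option-size o = ∸-pred (subst (_≤ m) (option-size o) (legal⇒size≤ legal-Q))
    where
    ∸-pred : ∀ {m p} → suc p ≤ m → m ∸ p ≡ suc (m ∸ suc p)
    ∸-pred {suc m} (s≤s p≤m) = +-∸-assoc 1 p≤m

  remaining-moves-parity : NimAssignment G (λ P → (m ∸ ∣ P ∣) % 2)
  remaining-moves-parity P legal = mex-below , options-differ
    where
    options-differ : ∀ Q → Option G P Q → (m ∸ ∣ Q ∣) % 2 ≢ (m ∸ ∣ P ∣) % 2
    options-differ Q o eq = n%2≢[1+n]%2 (m ∸ ∣ Q ∣) (trans eq (cong (_% 2) (option⇒remaining-moves o)))

    mex-below : ∀ j → j < (m ∸ ∣ P ∣) % 2 → ∃ λ Q → Option G P Q × (m ∸ ∣ Q ∣) % 2 ≡ j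
    mex-below j j< with ∣ P ∣ <? m
    ... | no P≮m = contradiction (subst (λ r → j < r % 2) (m≤n⇒m∸n≡0 (≮⇒≥ P≮m)) j<) n≮0
    ... | yes P<m with Q , o ← legal⇒option legal P<m =
      Q , o , m<[1+n]%2⇒n%2≡m (m ∸ ∣ Q ∣) (subst (λ r → j < r % 2) (option⇒remaining-moves o) j<)

Adj-sym : (G : Graph n) → Adj G u v → Adj G v u
Adj-sym G u~v = trans (sym G _ _) u~v

Adj⇒≢ : (G : Graph n) → Adj G u v → u ≢ v
Adj⇒≢ G u~u refl with () ← trans (≡.sym u~u) (irrefl G _)

Adj? : (G : Graph n) → ∀ u v → Dec (Adj G u v)
Adj? G u v = adj G u v Bool.≟ true

x∈∁⁅y⁆⁺ : x ≢ y → x ∈ ∁ ⁅ y ⁆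
x∈∁⁅y⁆⁺ = x∉p⇒x∈∁p ∘ x≢y⇒x∉⁅y⁆

x∈∁⁅y⁆⁻ : x ∈ ∁ ⁅ y ⁆ → x ≢ y
x∈∁⁅y⁆⁻ = x∉⁅y⁆⇒x≢y ∘ x∈∁p⇒x∉p

x∈p─y⁺ : x ∈ S → x ≢ y → x ∈ S ─ y
x∈p─y⁺ x∈S x≢y = x∈p∩q⁺ (x∈S , x∈∁⁅y⁆⁺ x≢y)

x∈p─y⁻ : ∀ S → x ∈ S ─ y → x ∈ S × x ≢ y
x∈p─y⁻ S x∈S─y with x∈p∩q⁻ S _ x∈S─y
... | x∈S , x∉y = x∈S , x∈∁⁅y⁆⁻ x∉y

─-mono : S ⊆ T → S ─ y ⊆ T ─ y
─-mono {S = S} S⊆T x∈S─y with x∈p─y⁻ S x∈S─y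
... | x∈S , x≢y = x∈p─y⁺ (S⊆T x∈S) x≢y

x∈p∪⁅x⁆ : x ∈ S ∪ ⁅ x ⁆
x∈p∪⁅x⁆ {x = x} {S = S} = q⊆p∪q S ⁅ x ⁆ (x∈⁅x⁆ x)

x∈p⇒x∈p∪⁅y⁆ : x ∈ S → x ∈ S ∪ ⁅ y ⁆
x∈p⇒x∈p∪⁅y⁆ {y = y} = p⊆p∪q ⁅ y ⁆

x∈p∪⁅y⁆⁻ : ∀ S → x ∈ S ∪ ⁅ y ⁆ → x ∈ S ⊎ x ≡ y
x∈p∪⁅y⁆⁻ {y = y} S = Sum.map₂ (x∈⁅y⁆⇒x≡y y) ∘ x∈p∪q⁻ S ⁅ y ⁆

Reach : Graph n → Subset n → Fin n → Fin n → Set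
Reach G S u v = ∃ (WalkIn G S u v)

_++_ : WalkIn G S u v k → WalkIn G S v w l → WalkIn G S u w (k + l)
here _ ++ ω = ω
step u∈S u~x ρ ++ ω = step u∈S u~x (ρ ++ ω)

snoc : WalkIn G S u v k → Adj G v w → w ∈ S → WalkIn G S u w (suc k)
snoc (here v∈S) v~w w∈S = step v∈S v~w (here w∈S)
snoc (step u∈S u~x ρ) v~w w∈S = step u∈S u~x (snoc ρ v~w w∈S)

reverse : WalkIn G S u v k → WalkIn G S v u k
reverse (here u∈S) = here u∈S
reverse {G = G} (step u∈S u~x ρ) = snoc (reverse ρ) (Adj-sym G u~x) u∈S

widen : S ⊆ T → WalkIn G S u v k → WalkIn G T u v k
widen S⊆T (here u∈S) = here (S⊆T u∈S)
widen S⊆T (step u∈S u~x ρ) = step (S⊆T u∈S) u~x (widen S⊆T ρ)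

ConnectedIn-via : ∀ h → (∀ {u} → u ∈ S → Reach G S u h) → ConnectedIn G S
ConnectedIn-via h reach u v u∈S v∈S with reach u∈S | reach v∈S
... | _ , ρ | _ , σ = _ , ρ ++ reverse σ

OnWalk-snoc : {ω : WalkIn G S u v k} {v~w : Adj G v w} {w∈S : w ∈ S} →
              OnWalk x ω → OnWalk x (snoc ω v~w w∈S)
OnWalk-snoc at-here = at-step
OnWalk-snoc at-step = at-step
OnWalk-snoc (later x∈ω) = later (OnWalk-snoc x∈ω)

OnWalk-snoc-end : (ω : WalkIn G S u v k) {v~w : Adj G v w} {w∈S : w ∈ S} → OnWalk w (snoc ω v~w w∈S)
OnWalk-snoc-end (here _) = later at-here
OnWalk-snoc-end (step _ _ ρ) = later (OnWalk-snoc-end ρ)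

OnWalk-reverse : {ω : WalkIn G S u v k} → OnWalk x ω → OnWalk x (reverse ω)
OnWalk-reverse at-here = at-here
OnWalk-reverse {ω = step _ _ ρ} at-step = OnWalk-snoc-end (reverse ρ)
OnWalk-reverse (later x∈ω) = OnWalk-snoc (OnWalk-reverse x∈ω)

vertices : {G : Graph n} {S : Subset n} → WalkIn G S u v k → Subset n
vertices (here {u = u} _) = ⁅ u ⁆
vertices (step {u = u} _ _ ρ) = vertices ρ ∪ ⁅ u ⁆

start∈vertices : (ω : WalkIn G S u v k) → u ∈ vertices ω
start∈vertices (here {u = u} _) = x∈⁅x⁆ u
start∈vertices (step _ _ _) = x∈p∪⁅x⁆

end∈vertices : (ω : WalkIn G S u v k) → v ∈ vertices ω
end∈vertices (here {u = u} _) = x∈⁅x⁆ u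
end∈vertices (step _ _ ρ) = x∈p⇒x∈p∪⁅y⁆ (end∈vertices ρ)

vertices⊆ : (ω : WalkIn G S u v k) → vertices ω ⊆ S
vertices⊆ (here {u = u} u∈S) x∈ω with refl ← x∈⁅y⁆⇒x≡y u x∈ω = u∈S
vertices⊆ (step u∈S _ ρ) x∈ω with x∈p∪⁅y⁆⁻ (vertices ρ) x∈ω
... | inj₁ x∈ρ = vertices⊆ ρ x∈ρ
... | inj₂ refl = u∈S

restrict : (ω : WalkIn G S u v k) → vertices ω ⊆ T → WalkIn G T u v k
restrict (here {u = u} _) ω⊆T = here (ω⊆T (x∈⁅x⁆ u))
restrict (step _ u~x ρ) ω⊆T = step (ω⊆T x∈p∪⁅x⁆) u~x (restrict ρ (ω⊆T ∘ x∈p⇒x∈p∪⁅y⁆))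

Simple : {G : Graph n} {S : Subset n} → WalkIn G S u v k → Set
Simple (here _) = ⊤
Simple (step {u = u} _ _ ρ) = u ∉ vertices ρ × Simple ρ

∣vertices∣≡1+length : (ω : WalkIn G S u v k) → Simple ω → ∣ vertices ω ∣ ≡ suc k
∣vertices∣≡1+length (here {u = u} _) _ = ∣⁅x⁆∣≡1 u
∣vertices∣≡1+length (step _ _ ρ) (u∉ρ , simple-ρ) =
  trans (x∉p⇒∣p∪⁅x⁆∣≡1+∣p∣ u∉ρ) (cong suc (∣vertices∣≡1+length ρ simple-ρ))

record Suffix {G : Graph n} {S : Subset n} (ω : WalkIn G S u v k) (x : Fin n) : Set where
  field
    {length} : ℕ
    walk     : WalkIn G S x v length
    length≤  : length ≤ k
    length<  : x ≢ u → length < k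
    ⊆ω       : vertices walk ⊆ vertices ω
    simple   : Simple ω → Simple walk

suffix : (ω : WalkIn G S u v k) → x ∈ vertices ω → Suffix ω x
suffix (here {u = u} u∈S) x∈ω with refl ← x∈⁅y⁆⇒x≡y u x∈ω =
  record { walk = here u∈S ; length≤ = ≤-refl ; length< = contradiction refl ; ⊆ω = id ; simple = id }
suffix ω@(step _ _ ρ) x∈ω with x∈p∪⁅y⁆⁻ (vertices ρ) x∈ω
... | inj₂ refl =
  record { walk = ω ; length≤ = ≤-refl ; length< = contradiction refl ; ⊆ω = id ; simple = id }
... | inj₁ x∈ρ = record
  { walk    = walk
  ; length≤ = m≤n⇒m≤1+n length≤
  ; length< = λ _ → s≤s length≤
  ; ⊆ω      = x∈p⇒x∈p∪⁅y⁆ ∘ ⊆ω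
  ; simple  = simple ∘ proj₂
  }
  where open Suffix (suffix ρ x∈ρ)

simplify : WalkIn G S u v k → ∃ λ l → Σ (WalkIn G S u v l) Simple
simplify (here u∈S) = 0 , here u∈S , tt
simplify (step {u = u} u∈S u~x ρ) with simplify ρ
... | l , σ , simple-σ with u ∈? vertices σ
... | no u∉σ = suc l , step u∈S u~x σ , u∉σ , simple-σ
... | yes u∈σ = length , walk , simple simple-σ
  where open Suffix (suffix σ u∈σ)

-- Geodesics and simplicial vertices

DistanceAtLeast : Graph n → ℕ → Fin n → Fin n → Set
DistanceAtLeast G k u v = ∀ l → Walk G u v l → k ≤ l

geodesic-length< : {G : Graph n} → Geodesic G u v k → k < n
geodesic-length< (ω , shortest) with simplify ω
... | l , σ , simple-σ = ≤-trans (s≤s (shortest l σ))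
  (subst (_≤ _) (∣vertices∣≡1+length σ simple-σ) (∣p∣≤n (vertices σ)))

OnGeodesic : Graph n → Fin n → Fin n → Fin n → Set
OnGeodesic G x u v = ∃₂ λ k (γ : Geodesic G u v k) → OnWalk x (proj₁ γ)

OnGeodesic-sym : OnGeodesic G x u v → OnGeodesic G x v u
OnGeodesic-sym (k , (ω , shortest) , x∈ω) =
  k , (reverse ω , λ l → shortest l ∘ reverse) , OnWalk-reverse x∈ω

Simplicial : Graph n → Fin n → Set
Simplicial G s = ∀ a b → Adj G s a → Adj G s b → a ≢ b → Adj G a b

simplicial? : (G : Graph n) → ∀ s → Dec (Simplicial G s)
simplicial? G s =
  all? λ a → all? λ b → Adj? G s a →-dec (Adj? G s b →-dec (¬? (a ≟ b) →-dec Adj? G a b))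

shortcut : Simplicial G s → (ω : WalkIn G S u v k) → OnWalk s ω → s ≢ u → s ≢ v →
           ∃ λ l → l < k × WalkIn G S u v l
shortcut _ (here _) at-here s≢u _ = contradiction refl s≢u
shortcut _ (step _ _ _) at-step s≢u _ = contradiction refl s≢u
shortcut _ (step _ _ (here _)) (later at-here) _ s≢v = contradiction refl s≢v
shortcut {s = s} simp (step u∈S u~w (step {u = w} w∈S w~y ρ)) (later s∈ω) _ s≢v with s ≟ w
... | no s≢w with l , l< , σ ← shortcut simp (step w∈S w~y ρ) s∈ω s≢w s≢v =
  suc l , s≤s l< , step u∈S u~w σ
shortcut {G = G} simp (step {u = u} u∈S u~s (step {w = y} _ s~y ρ)) _ _ _ | yes refl with u ≟ y
... | yes refl = _ , m≤n⇒m≤1+n ≤-refl , ρ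
... | no u≢y = _ , ≤-refl , step u∈S (simp _ _ (Adj-sym G u~s) s~y u≢y) ρ

simplicial⇒convex-complement : Simplicial G s → Convex G (∁ ⁅ s ⁆)
simplicial⇒convex-complement {s = s} simp u v k u∈∁s v∈∁s (ω , shortest) x x∈ω with x ≟ s
... | no x≢s = x∈∁⁅y⁆⁺ x≢s
... | yes refl
  with l , l<k , σ ← shortcut simp ω x∈ω (≢-sym (x∈∁⁅y⁆⁻ u∈∁s)) (≢-sym (x∈∁⁅y⁆⁻ v∈∁s)) =
  contradiction (shortest l σ) (<⇒≱ l<k)

avoids-simplicial⇒¬generating : Simplicial G s → s ∉ P → ¬ Generating G P
avoids-simplicial⇒¬generating {s = s} simp s∉P generating =
  x∈∁⁅y⁆⁻ (generating s (∁ ⁅ s ⁆) (simplicial⇒convex-complement simp) P⊆∁s) refl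
  where
  P⊆∁s : _ ⊆ ∁ ⁅ s ⁆
  P⊆∁s x∈P = x∈∁⁅y⁆⁺ λ { refl → s∉P x∈P }

-- Blocks

Maximal : (Subset n → Set) → Subset n → Set
Maximal Pr T = Pr T × (∀ U → T ⊆ U → Pr U → U ⊆ T)

¬¬-maximal : (Pr : Subset n → Set) → Pr S → ¬ ¬ ∃ λ T → S ⊆ T × Maximal Pr T
¬¬-maximal Pr = go (⊃-wellFounded _)
  where
  go : ∀ {S} → Acc _⊃_ S → Pr S → ¬ ¬ ∃ λ T → S ⊆ T × Maximal Pr T
  go {S} (acc larger) Pr-S no-maximal-above-S = ¬¬-excluded-middle {A = Larger} λ where
      (yes (U , S⊂U , Pr-U)) → go (larger S⊂U) Pr-U λ (T , U⊆T , maximal-T) →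
        no-maximal-above-S (T , ⊆-trans (proj₁ S⊂U) U⊆T , maximal-T)
      (no none-larger) → no-maximal-above-S (S , ⊆-refl , Pr-S , maximal none-larger)
    where
    Larger : Set
    Larger = ∃ λ U → S ⊂ U × Pr U

    maximal : ¬ Larger → ∀ U → S ⊆ U → Pr U → U ⊆ S
    maximal none-larger U S⊆U Pr-U {x} x∈U =
      decidable-stable (x ∈? S) λ x∉S → none-larger (U , (S⊆U , x , x∈U , x∉S) , Pr-U)

-- The block containing S only exists under ¬¬ (biconnectivity is not decidable),
-- which suffices because adjacency is decidable.
biconnected⇒complete : IsBlockGraph G → Biconn G S → u ∈ S → v ∈ S → u ≢ v → Adj G u v
biconnected⇒complete {G = G} {u = u} {v = v} block biconnected u∈S v∈S u≢v =
  decidable-stable (Adj? G u v) λ u≁v → ¬¬-maximal (Biconn G) biconnected λ (B , S⊆B , block-B) →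
    u≁v (block B block-B u v (S⊆B u∈S) (S⊆B v∈S) u≢v)

Reach-snoc : Reach G S u v → Adj G v w → w ∈ S → Reach G S u w
Reach-snoc (_ , ρ) v~w w∈S = _ , snoc ρ v~w w∈S

Reach-widen : S ⊆ T → Reach G S u v → Reach G T u v
Reach-widen S⊆T (_ , ρ) = _ , widen S⊆T ρ

simple-walk-reaches-an-end : (ω : WalkIn G S a c k) → Simple ω → u ∈ vertices ω → u ≢ z →
                             Reach G (vertices ω ─ z) u a ⊎ Reach G (vertices ω ─ z) u c
simple-walk-reaches-an-end (here {u = a} _) _ u∈ω u≢z with refl ← x∈⁅y⁆⇒x≡y a u∈ω =
  inj₁ (0 , here (x∈p─y⁺ u∈ω u≢z))
simple-walk-reaches-an-end {G = G} {z = z} (step {u = a} _ a~x ρ) (a∉ρ , simple-ρ) u∈ω u≢z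
  with x∈p∪⁅y⁆⁻ (vertices ρ) u∈ω
... | inj₂ refl = inj₁ (0 , here (x∈p─y⁺ u∈ω u≢z))
... | inj₁ u∈ρ with z ≟ a
...   | yes refl = inj₂ (_ , restrict walk λ y∈σ →
          x∈p─y⁺ (x∈p⇒x∈p∪⁅y⁆ (⊆ω y∈σ)) λ { refl → a∉ρ (⊆ω y∈σ) })
  where open Suffix (suffix ρ u∈ρ)
...   | no z≢a with simple-walk-reaches-an-end ρ simple-ρ u∈ρ u≢z
...     | inj₁ reach-x = inj₁ (Reach-snoc (Reach-widen (─-mono x∈p⇒x∈p∪⁅y⁆) reach-x) (Adj-sym G a~x)
                                       (x∈p─y⁺ x∈p∪⁅x⁆ (≢-sym z≢a)))
...     | inj₂ reach-c = inj₂ (Reach-widen (─-mono x∈p⇒x∈p∪⁅y⁆) reach-c)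

cycle-biconnected : Adj G b a → Adj G b c → (ω : WalkIn G (∁ ⁅ b ⁆) a c k) → Simple ω →
                    Biconn G (vertices ω ∪ ⁅ b ⁆)
cycle-biconnected {G = G} {b = b} {c = c} b~a b~c ω simple-ω = connected , connected-without
  where
  C : Subset _
  C = vertices ω ∪ ⁅ b ⁆

  toward-c : u ∈ vertices ω → vertices ω ⊆ T → Reach G T u c
  toward-c u∈ω ω⊆T = _ , restrict walk (ω⊆T ∘ ⊆ω)
    where open Suffix (suffix ω u∈ω)

  connected : ConnectedIn G C
  connected = ConnectedIn-via b λ u∈C → case x∈p∪⁅y⁆⁻ (vertices ω) u∈C of λ where
    (inj₂ refl) → 0 , here x∈p∪⁅x⁆
    (inj₁ u∈ω) → Reach-snoc (toward-c u∈ω x∈p⇒x∈p∪⁅y⁆) (Adj-sym G b~c) x∈p∪⁅x⁆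

  connected-without : ∀ z → z ∈ C → ConnectedIn G (C ─ z)
  connected-without z _ with z ≟ b
  ... | yes refl = ConnectedIn-via c λ {u} u∈C─b → case x∈p─y⁻ C u∈C─b of λ where
    (u∈C , u≢b) → case x∈p∪⁅y⁆⁻ (vertices ω) u∈C of λ where
      (inj₂ u≡b) → contradiction u≡b u≢b
      (inj₁ u∈ω) → toward-c u∈ω λ y∈ω →
        x∈p─y⁺ (x∈p⇒x∈p∪⁅y⁆ y∈ω) (x∈∁⁅y⁆⁻ (vertices⊆ ω y∈ω))
  ... | no z≢b = ConnectedIn-via b λ {u} u∈C─z → case x∈p─y⁻ C u∈C─z of λ where
      (u∈C , u≢z) → case x∈p∪⁅y⁆⁻ (vertices ω) u∈C of λ where
        (inj₂ refl) → 0 , here u∈C─z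
        (inj₁ u∈ω) → case simple-walk-reaches-an-end ω simple-ω u∈ω u≢z of λ where
          (inj₁ reach-a) → Reach-snoc (Reach-widen ω─z⊆C─z reach-a) (Adj-sym G b~a) b∈C─z
          (inj₂ reach-c) → Reach-snoc (Reach-widen ω─z⊆C─z reach-c) (Adj-sym G b~c) b∈C─z
    where
    b∈C─z : b ∈ C ─ z
    b∈C─z = x∈p─y⁺ x∈p∪⁅x⁆ (≢-sym z≢b)
    ω─z⊆C─z : vertices ω ─ z ⊆ C ─ z
    ω─z⊆C─z = ─-mono x∈p⇒x∈p∪⁅y⁆

block-graph-separates : IsBlockGraph G → Adj G b a → Adj G b c → a ≢ c → ¬ Adj G a c →
                        ¬ WalkIn G (∁ ⁅ b ⁆) a c k
block-graph-separates block b~a b~c a≢c a≁c ρ with _ , ω , simple-ω ← simplify ρ =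
  a≁c (biconnected⇒complete block (cycle-biconnected b~a b~c ω simple-ω)
        (x∈p⇒x∈p∪⁅y⁆ (start∈vertices ω)) (x∈p⇒x∈p∪⁅y⁆ (end∈vertices ω)) a≢c)

short-walk-avoids : DistanceAtLeast G k b v → a ≢ b → (ω : Walk G a v l) → l ≤ k →
                    vertices ω ⊆ ∁ ⁅ b ⁆
short-walk-avoids {b = b} far a≢b ω l≤k {y} y∈ω with y ≟ b
... | no y≢b = x∈∁⁅y⁆⁺ y≢b
... | yes refl = contradiction (far length walk) (<⇒≱ (<-≤-trans (length< (≢-sym a≢b)) l≤k))
  where open Suffix (suffix ω y∈ω)

-- If two non-adjacent neighbours a and c of b both had walks of length ≤ k to v,
-- these walks would avoid b and so join a and c around b.
geodesic-extends : IsBlockGraph G → DistanceAtLeast G k b v → ¬ Simplicial G b →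
                   ¬ ¬ ∃ λ c → Adj G c b × DistanceAtLeast G (suc k) c v
geodesic-extends {G = G} {k = k} {b = b} {v = v} block far ¬simplicial no-extension =
  ¬simplicial λ a c b~a b~c a≢c → decidable-stable (Adj? G a c) λ a≁c →
    near b~a λ (_ , l≤k , ρ) → near b~c λ (_ , l≤k′ , σ) →
      block-graph-separates block b~a b~c a≢c a≁c
        (restrict ρ (short-walk-avoids far (≢-sym (Adj⇒≢ G b~a)) ρ l≤k) ++
         reverse (restrict σ (short-walk-avoids far (≢-sym (Adj⇒≢ G b~c)) σ l≤k′)))
  where
  near : Adj G b a → ¬ ¬ ∃ λ l → l ≤ k × Walk G a v l
  near {a} b~a none-near =
    no-extension (a , Adj-sym G b~a , λ l ρ → ≰⇒> λ l≤k → none-near (l , l≤k , ρ))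

toward-simplicial : {G : Graph n} → IsBlockGraph G → OnGeodesic G x u v →
                    ¬ ¬ ∃ λ s → Simplicial G s × OnGeodesic G x s v
toward-simplicial {n = n} {x = x} {v = v} {G = G} block (k , γ , x∈γ) = go n γ x∈γ (m≤n+m n k)
  where
  -- f bounds the number of prolongations, as geodesics are shorter than n.
  go : ∀ {u k} f (γ : Geodesic G u v k) → OnWalk x (proj₁ γ) → n ≤ k + f →
       ¬ ¬ ∃ λ s → Simplicial G s × OnGeodesic G x s v
  go {u} f γ x∈γ n≤k+f with simplicial? G u
  ... | yes simplicial-u = return (u , simplicial-u , _ , γ , x∈γ)
  go zero γ _ n≤k+0 | no _ =
    contradiction (subst (n ≤_) (+-identityʳ _) n≤k+0) (<⇒≱ (geodesic-length< γ))
  go (suc f) (ω , far) x∈ω n≤k+1+f | no ¬simplicial = do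
    (c , c~u , far′) ← geodesic-extends block far ¬simplicial
    go f (step ∈⊤ c~u ω , far′) (later x∈ω) (subst (n ≤_) (+-suc _ f) n≤k+1+f)

between-simplicial : {G : Graph n} → IsBlockGraph G → ∀ x →
                     ¬ ¬ ∃₂ λ s t → Simplicial G s × Simplicial G t × OnGeodesic G x s t
between-simplicial block x = do
  (t , simplicial-t , x∈γ) ← toward-simplicial block (0 , (here ∈⊤ , λ _ _ → z≤n) , at-here)
  (s , simplicial-s , x∈γ′) ← toward-simplicial block (OnGeodesic-sym x∈γ)
  return (s , t , simplicial-s , simplicial-t , x∈γ′)

simplicial-generating : IsBlockGraph G → (∀ s → Simplicial G s → s ∈ P) → Generating G P
simplicial-generating block P∋simplicial x C convex P⊆C = decidable-stable (x ∈? C) λ x∉C →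
  between-simplicial block x λ (s , t , simplicial-s , simplicial-t , k , γ , x∈γ) →
    x∉C (convex s t k (P⊆C (P∋simplicial s simplicial-s)) (P⊆C (P∋simplicial t simplicial-t)) γ x x∈γ)

-- The avoidance game on a block graph

legal⇒size< : {G : Graph n} → Legal G P → ∣ P ∣ < n
legal⇒size< {P = P} {G = G} legal =
  ≤∧≢⇒< (∣p∣≤n P) λ ∣P∣≡n →
    legal (subst (Generating G) (≡.sym (∣p∣≡n⇒p≡⊤ ∣P∣≡n)) full-generating)
  where
  full-generating : Generating G full
  full-generating _ _ _ full⊆C = full⊆C ∈⊤

simplicial-outside : IsBlockGraph G → Legal G P → ∃ λ s → Simplicial G s × s ∉ P
simplicial-outside {G = G} {P = P} block legal with any? (λ s → simplicial? G s ×-dec ¬? (s ∈? P))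
... | yes found = found
... | no none = contradiction (simplicial-generating block λ s simplicial-s →
                  decidable-stable (s ∈? P) λ s∉P → none (s , simplicial-s , s∉P)) legal

legal-extends : {G : Graph n} → IsBlockGraph G → Legal G P → suc ∣ P ∣ < n → ∃ (Option G P)
legal-extends {P = P} block legal 1+P<n
  with s , simplicial-s , s∉P ← simplicial-outside block legal
  with v , v∉P∪s ← ∣p∣<n⇒∃∉ {p = P ∪ ⁅ s ⁆} (subst (_< _) (≡.sym (x∉p⇒∣p∪⁅x⁆∣≡1+∣p∣ s∉P)) 1+P<n) =
  P ∪ ⁅ v ⁆ , v , v∉P∪s ∘ x∈p⇒x∈p∪⁅y⁆ , refl ,
  avoids-simplicial⇒¬generating simplicial-s s∉P∪v
  where
  s∉P∪v : s ∉ P ∪ ⁅ v ⁆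
  s∉P∪v s∈ = case x∈p∪⁅y⁆⁻ P s∈ of λ where
    (inj₁ s∈P) → s∉P s∈P
    (inj₂ refl) → v∉P∪s x∈p∪⁅x⁆

proposition6p17 : (m : ℕ) (G : Graph (suc m)) → Connected G → IsBlockGraph G →
                    NimDNG≡ G (1 ∸ pty (suc m))
proposition6p17 m G _ block = (λ P → (m ∸ ∣ P ∣) % 2) , nim-assignment , start-position
  where
  nim-assignment : NimAssignment G (λ P → (m ∸ ∣ P ∣) % 2)
  nim-assignment =
    remaining-moves-parity G m (≤-pred ∘ legal⇒size<) (λ legal → legal-extends block legal ∘ s≤s)

  start-position : (m ∸ ∣ ∅ {suc m} ∣) % 2 ≡ 1 ∸ pty (suc m)
  start-position = trans (cong (λ c → (m ∸ c) % 2) (∣⊥∣≡0 (suc m))) (n%2≡1∸[1+n]%2 m)
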